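{- The map from the set of naturally labeled trees with vertex set $\{0,\dots,n\}$ to the set of ordered rooted trees with $n+1$ vertices, which orders the children of each vertex increasingly according to their labels and then forgets all labels, is a bijection.
   Context: A rooted tree with vertex set $\{0,\dots,n\}$ is naturally labeled if every vertex has a smaller label than its parent and, for every $i<n$, the labels of all children of $i$ are smaller than the labels of all children of $i+1$. An ordered rooted tree is an unlabeled rooted tree together with a linear order on the children of each vertex.
   Formalization: The natural labeling condition compares the children of any two vertices, not only of i and i+1: all children of a smaller vertex have smaller labels than all children of a larger vertex. The statement above fails without it. -}

module Defs where

open import Data.Nat using (ℕ; zero; suc; _+_; _<_)
open import Data.Fin using (Fin; toℕ; inject₁; fromℕ)
open import Data.Fin.Properties using (_≟_)
open import Data.Vec using (Vec; lookup)
open import Data.List using (List; []; _∷_; map; filter; allFin)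
open import Relation.Binary.PropositionalEquality using (_≡_)

-- Since every non-root vertex has a smaller label than its parent, the root
-- is necessarily the vertex n, and the tree is determined by the parent of
-- each vertex i ∈ {0,…,n-1}, stored in the vector `parent`.
-- Conversely any such parent map with toℕ i < toℕ (parent i) defines a
-- rooted tree on {0,…,n} with root n (following parents strictly increases
-- labels, so there are no cycles).
record NatLabeledTree (n : ℕ) : Set where
  field
    parent     : Vec (Fin (suc n)) n
    decreasing : ∀ (i : Fin n) → toℕ i < toℕ (lookup parent i)
    natural    : ∀ (a b : Fin n) → toℕ (lookup parent a) < toℕ (lookup parent b)
                   → toℕ a < toℕ b
open NatLabeledTree public

data OTree : Set where
  node : List OTree → OTree

mutual
  size : OTree → ℕ
  size (node ts) = suc (sizes ts)

  sizes : List OTree → ℕ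
  sizes []       = 0
  sizes (t ∷ ts) = size t + sizes ts

children : ∀ {n} → NatLabeledTree n → Fin (suc n) → List (Fin n)
children T v = filter (λ i → lookup (parent T) i ≟ v) (allFin _)

-- The fuel argument only ensures termination; the depth of the
-- tree is at most n, so fuel (suc n) at the root is always sufficient.
subtree : ∀ {n} → NatLabeledTree n → ℕ → Fin (suc n) → OTree
subtree T zero    v = node []
subtree T (suc f) v = node (map (λ i → subtree T f (inject₁ i)) (children T v))

toOrdered : ∀ {n} → NatLabeledTree n → OTree
toOrdered {n} T = subtree T (suc n) (fromℕ n)

{-# OPTIONS --safe #-}
module Submission where

-- Process the vertices 0, 1, …, n−1 of a naturally labeled tree in increasing order, keeping a
-- queue of the ordered subtrees whose roots still wait for their parent.  Parents increase weakly
-- with the label, so the children of v are exactly the c_v oldest entries of the queue: v takes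
-- them, in order, as its subtrees and joins the end of the queue; at the end the root takes all
-- that is left.  So the ordered tree is the output of a queue machine driven by the child counts
-- (c_0, …, c_{n−1}).
--
-- The machine is injective on admissible count sequences (no step takes more than the whole
-- queue), and every ordered forest with m vertices is the output of an admissible sequence of
-- length m: remove the last tree and put its subtrees in front of the others.  Admissible
-- sequences are exactly the child counts of naturally labeled trees, and the counts determine
-- the tree, because parent(i) < v iff i < c_0 + ⋯ + c_{v−1}.

open import Defs
open import Data.Fin using (Fin; toℕ; fromℕ; fromℕ<; inject₁) renaming (zero to fzero; suc to fsuc)
open import Data.Fin.Properties
  using (_≟_; toℕ<n; toℕ-fromℕ<; toℕ-fromℕ; toℕ-inject₁; toℕ-injective)
open import Data.List
  using ( List; []; _∷_; _++_; _∷ʳ_; length; lookup; map; filter; foldl; take; drop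
        ; tabulate; allFin; applyUpTo; upTo)
open import Data.List.Properties
  using ( take++drop≡id; take-drop; take-map; drop-map; drop-drop; drop-[]; take-[]; take-all
        ; take-suc; drop-all; length-++; length-++-≤ˡ; length-take; length-drop; length-upTo
        ; ∷ʳ-injective; map-++; map-∘; map-tabulate; map-cong-local; upTo-∷ʳ; foldl-∷ʳ
        ; filter-accept; filter-reject; filter-none)
open import Data.List.Relation.Unary.All as All using (All)
open import Data.List.Relation.Unary.All.Properties using (all-filter; tabulate⁺)
open import Data.List.Reverse using (reverseView; _∶_∶ʳ_)
open import Data.Nat using (ℕ; zero; suc; _+_; _∸_; _⊓_; _≤_; _<_; z≤n; s≤s; s≤s⁻¹; _<?_)
open import Data.Nat.ListAction using (sum)
open import Data.Nat.ListAction.Properties using (sum-++)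
open import Data.Nat.Properties
  using ( +-assoc; +-comm; +-suc; +-identityʳ; +-monoˡ-≤; +-monoʳ-≤; +-monoʳ-<; +-cancelˡ-≤
        ; +-cancelˡ-<; m+[n∸m]≡n; m≤m+n; m⊓n≤n; m≤n⇒m⊓n≡m; suc-injective; n≤1+n; m<n⇒m<1+n
        ; n≤0⇒n≡0; ≤-refl; ≤-trans; ≤-reflexive; ≤-antisym; <-≤-trans; ≤-<-trans; <⇒≤
        ; <-irrefl; ≮⇒≥; ≰⇒>; <⇒≱; module ≤-Reasoning)
open import Data.Product using (∃; _×_; _,_; proj₁; proj₂)
open import Data.Unit using (⊤; tt)
open import Data.Vec using (Vec) renaming (lookup to lookupᵥ; tabulate to tabulateᵥ)
open import Data.Vec.Properties
  using (lookup∘tabulate; tabulate∘lookup) renaming (tabulate-cong to tabulateᵥ-cong)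
open import Function using (_∘_; _⇔_; mk⇔; Equivalence)
open import Relation.Nullary using (yes; no; contradiction)
open import Relation.Unary using (Pred; Decidable)
open import Relation.Binary.PropositionalEquality
  using (_≡_; refl; sym; trans; cong; cong₂; subst; subst₂; module ≡-Reasoning)

open Equivalence using (to; from)

private
  variable
    A : Set

take-length-++ : ∀ (xs ys : List A) → take (length xs) (xs ++ ys) ≡ xs
take-length-++ []       ys = refl
take-length-++ (x ∷ xs) ys = cong (x ∷_) (take-length-++ xs ys)

drop-++ : ∀ k (xs ys : List A) → k ≤ length xs → drop k (xs ++ ys) ≡ drop k xs ++ ys
drop-++ zero    xs       ys _        = refl
drop-++ (suc k) (x ∷ xs) ys (s≤s k≤) = drop-++ k xs ys k≤

take-suc-∷ʳ : ∀ (xs : List A) {k} → k < length xs → ∃ λ x → take (suc k) xs ≡ take k xs ∷ʳ x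
take-suc-∷ʳ xs k<len =
  lookup xs i ,
  subst (λ m → take (suc m) xs ≡ take m xs ∷ʳ lookup xs i) (toℕ-fromℕ< k<len) (take-suc xs i)
  where i = fromℕ< k<len

take-applyUpTo : ∀ (f : ℕ → A) {k n} → k ≤ n → take k (applyUpTo f n) ≡ applyUpTo f k
take-applyUpTo f z≤n      = refl
take-applyUpTo f (s≤s k≤) = cong (f 0 ∷_) (take-applyUpTo (f ∘ suc) k≤)

tabulate-applyUpTo : ∀ n (f : ℕ → A) → tabulate {n = n} (f ∘ toℕ) ≡ applyUpTo f n
tabulate-applyUpTo zero    f = refl
tabulate-applyUpTo (suc n) f = cong (f 0 ∷_) (tabulate-applyUpTo n (f ∘ suc))

map-toℕ-allFin : ∀ n → map toℕ (allFin n) ≡ upTo n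
map-toℕ-allFin n = trans (map-tabulate (λ i → i) toℕ) (tabulate-applyUpTo n (λ k → k))

range : ℕ → ℕ → List ℕ
range a b = drop a (upTo b)

take-range : ∀ a c {b} → a + c ≤ b → take c (range a b) ≡ range a (a + c)
take-range a c {b} a+c≤b = trans (take-drop c a (upTo b)) (cong (drop a) (take-applyUpTo (λ k → k) a+c≤b))

drop-range : ∀ a c b → drop c (range a b) ≡ range (a + c) b
drop-range a c b = drop-drop a c (upTo b)

range-∷ʳ : ∀ {a b} → a ≤ b → range a b ∷ʳ b ≡ range a (suc b)
range-∷ʳ {a} {b} a≤b = begin
  drop a (upTo b) ++ b ∷ []   ≡⟨ drop-++ a (upTo b) _ (subst (a ≤_) (sym (length-upTo b)) a≤b) ⟨
  drop a (upTo b ++ b ∷ [])   ≡⟨ cong (drop a) (upTo-∷ʳ b) ⟩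
  drop a (upTo (suc b))       ∎
  where open ≡-Reasoning

map-toℕ-take-drop-allFin : ∀ {n} a c → a + c ≤ n →
                           map toℕ (take c (drop a (allFin n))) ≡ range a (a + c)
map-toℕ-take-drop-allFin {n} a c a+c≤n = begin
  map toℕ (take c (drop a (allFin n)))   ≡⟨ take-map c _ ⟨
  take c (map toℕ (drop a (allFin n)))   ≡⟨ cong (take c) (drop-map a (allFin n)) ⟨
  take c (drop a (map toℕ (allFin n)))   ≡⟨ cong (take c ∘ drop a) (map-toℕ-allFin n) ⟩
  take c (range a n)                     ≡⟨ take-range a c a+c≤n ⟩
  range a (a + c)                        ∎
  where open ≡-Reasoning

filter-tabulate-segment :
  ∀ {ℓ n} {P : Pred A ℓ} (P? : Decidable P) (g : Fin n → A) a c →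
  (∀ i → P (g i) ⇔ (a ≤ toℕ i × toℕ i < a + c)) →
  filter P? (tabulate g) ≡ take c (drop a (tabulate g))
filter-tabulate-segment {n = zero} P? g a c _ = sym (trans (cong (take c) (drop-[] a)) (take-[] c))
filter-tabulate-segment {n = suc n} P? g (suc a) c seg =
  trans (filter-reject P? (λ P₀ → contradiction (proj₁ (to (seg fzero) P₀)) λ ()))
        (filter-tabulate-segment P? (g ∘ fsuc) a c λ i →
          mk⇔ (λ P → let a≤ , < = to (seg (fsuc i)) P in s≤s⁻¹ a≤ , s≤s⁻¹ <)
              (λ (a≤ , <) → from (seg (fsuc i)) (s≤s a≤ , s≤s <)))
filter-tabulate-segment {n = suc n} P? g zero zero seg =
  filter-none P? (tabulate⁺ λ i P → contradiction (proj₂ (to (seg i) P)) λ ())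
filter-tabulate-segment {n = suc n} P? g zero (suc c) seg =
  trans (filter-accept P? (from (seg fzero) (z≤n , s≤s z≤n)))
        (cong (g fzero ∷_) (filter-tabulate-segment P? (g ∘ fsuc) zero c λ i →
          mk⇔ (λ P → z≤n , s≤s⁻¹ (proj₂ (to (seg (fsuc i)) P)))
              (λ (_ , <) → from (seg (fsuc i)) (z≤n , s≤s <))))

-- The queue machine on ordered forests

node-injective : ∀ {ts us} → node ts ≡ node us → ts ≡ us
node-injective refl = refl

sizes-++ : ∀ (F G : List OTree) → sizes (F ++ G) ≡ sizes F + sizes G
sizes-++ []      G = refl
sizes-++ (t ∷ F) G = trans (cong (size t +_) (sizes-++ F G)) (sym (+-assoc (size t) (sizes F) (sizes G)))

sizes-∷ʳ-node : ∀ (F ts : List OTree) → sizes (F ∷ʳ node ts) ≡ suc (sizes (ts ++ F))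
sizes-∷ʳ-node F ts = begin
  sizes (F ++ node ts ∷ [])        ≡⟨ sizes-++ F _ ⟩
  sizes F + (suc (sizes ts) + 0)   ≡⟨ cong (sizes F +_) (+-identityʳ _) ⟩
  sizes F + suc (sizes ts)         ≡⟨ +-suc (sizes F) (sizes ts) ⟩
  suc (sizes F + sizes ts)         ≡⟨ cong suc (+-comm (sizes F) (sizes ts)) ⟩
  suc (sizes ts + sizes F)         ≡⟨ cong suc (sizes-++ ts F) ⟨
  suc (sizes (ts ++ F))            ∎
  where open ≡-Reasoning

graft : List OTree → ℕ → List OTree
graft F c = drop c F ∷ʳ node (take c F)

run : List OTree → List ℕ → List OTree
run = foldl graft

sizes-graft : ∀ F c → sizes (graft F c) ≡ suc (sizes F)
sizes-graft F c = trans (sizes-∷ʳ-node (drop c F) (take c F)) (cong (suc ∘ sizes) (take++drop≡id c F))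

sizes-run : ∀ F cs → sizes (run F cs) ≡ length cs + sizes F
sizes-run F []       = refl
sizes-run F (c ∷ cs) =
  trans (sizes-run (graft F c) cs) (trans (cong (length cs +_) (sizes-graft F c)) (+-suc _ _))

length-graft : ∀ F c → length (graft F c) ≡ suc (length F ∸ c)
length-graft F c = trans (length-++ (drop c F)) (trans (+-comm _ 1) (cong suc (length-drop c F)))

Admissible : List OTree → List ℕ → Set
Admissible F []       = ⊤
Admissible F (c ∷ cs) = c ≤ length F × Admissible (graft F c) cs

admissible-∷ʳ : ∀ F cs {c} → Admissible F cs → c ≤ length (run F cs) → Admissible F (cs ∷ʳ c)
admissible-∷ʳ F []       _          c≤ = c≤ , tt
admissible-∷ʳ F (d ∷ cs) (d≤ , adm) c≤ = d≤ , admissible-∷ʳ (graft F d) cs adm c≤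

graft-injective : ∀ {F F′ c c′} → c ≤ length F → c′ ≤ length F′ →
                  graft F c ≡ graft F′ c′ → c ≡ c′ × F ≡ F′
graft-injective {F} {F′} {c} {c′} c≤ c′≤ eq
  with drop≡ , node≡ ← ∷ʳ-injective (drop c F) (drop c′ F′) eq =
  c≡c′ , (begin
    F                          ≡⟨ take++drop≡id c F ⟨
    take c F ++ drop c F       ≡⟨ cong₂ _++_ take≡ drop≡ ⟩
    take c′ F′ ++ drop c′ F′   ≡⟨ take++drop≡id c′ F′ ⟩
    F′                         ∎)
  where
  open ≡-Reasoning
  take≡ : take c F ≡ take c′ F′
  take≡ = node-injective node≡
  c≡c′ : c ≡ c′
  c≡c′ = begin
    c                     ≡⟨ m≤n⇒m⊓n≡m c≤ ⟨
    c ⊓ length F          ≡⟨ length-take c F ⟨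
    length (take c F)     ≡⟨ cong length take≡ ⟩
    length (take c′ F′)   ≡⟨ length-take c′ F′ ⟩
    c′ ⊓ length F′        ≡⟨ m≤n⇒m⊓n≡m c′≤ ⟩
    c′                    ∎

run-injective : ∀ {F F′} cs cs′ → length cs ≡ length cs′ → Admissible F cs → Admissible F′ cs′ →
                run F cs ≡ run F′ cs′ → cs ≡ cs′ × F ≡ F′
run-injective []       []         _   _          _            eq = refl , eq
run-injective (c ∷ cs) (c′ ∷ cs′) len (c≤ , adm) (c′≤ , adm′) eq
  with cs≡ , graft≡ ← run-injective cs cs′ (suc-injective len) adm adm′ eq
  with c≡ , F≡ ← graft-injective c≤ c′≤ graft≡
  = cong₂ _∷_ c≡ cs≡ , F≡

graft-length-++ : ∀ (ts F : List OTree) → graft (ts ++ F) (length ts) ≡ F ∷ʳ node ts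
graft-length-++ ts F = cong₂ (λ G us → G ∷ʳ node us)
  (trans (drop-++ (length ts) ts F ≤-refl) (cong (_++ F) (drop-all (length ts) ts ≤-refl)))
  (take-length-++ ts F)

run-surjective : ∀ m F → sizes F ≡ m → ∃ λ cs → length cs ≡ m × Admissible [] cs × run [] cs ≡ F
run-surjective zero    []           _ = [] , refl , tt , refl
run-surjective zero    (node _ ∷ _) ()
run-surjective (suc m) F size≡ with reverseView F
... | G ∶ _ ∶ʳ node ts
  with cs , len , adm , run≡ ← run-surjective m (ts ++ G)
                                  (suc-injective (trans (sym (sizes-∷ʳ-node G ts)) size≡))
  = cs ∷ʳ length ts
  , trans (length-++ cs) (trans (+-comm _ 1) (cong suc len))
  , admissible-∷ʳ [] cs adm (subst (length ts ≤_) (cong length (sym run≡)) (length-++-≤ˡ ts))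
  , (begin
      run [] (cs ∷ʳ length ts)        ≡⟨ foldl-∷ʳ graft [] (length ts) cs ⟩
      graft (run [] cs) (length ts)   ≡⟨ cong (λ H → graft H (length ts)) run≡ ⟩
      graft (ts ++ G) (length ts)     ≡⟨ graft-length-++ ts G ⟩
      G ∷ʳ node ts                    ∎)
  where open ≡-Reasoning

-- Partial sums of count sequences

partialSum : ℕ → List ℕ → ℕ
partialSum v cs = sum (take v cs)

partialSum-∷ʳ : ∀ v cs {c} → take (suc v) cs ≡ take v cs ∷ʳ c →
                partialSum (suc v) cs ≡ partialSum v cs + c
partialSum-∷ʳ v cs {c} eq =
  trans (cong sum eq) (trans (sum-++ (take v cs) (c ∷ [])) (cong (partialSum v cs +_) (+-identityʳ c)))

+-length-graft : ∀ F c v → c ≤ length F → c + (length (graft F c) + v) ≡ length F + suc v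
+-length-graft F c v c≤ = begin
  c + (length (graft F c) + v)   ≡⟨ cong (λ k → c + (k + v)) (length-graft F c) ⟩
  c + (suc (length F ∸ c) + v)   ≡⟨ +-assoc c _ v ⟨
  c + suc (length F ∸ c) + v     ≡⟨ cong (_+ v) (+-suc c _) ⟩
  suc (c + (length F ∸ c)) + v   ≡⟨ cong (λ k → suc k + v) (m+[n∸m]≡n c≤) ⟩
  suc (length F) + v             ≡⟨ +-suc (length F) v ⟨
  length F + suc v               ∎
  where open ≡-Reasoning

admissible⇒bounded : ∀ F cs → Admissible F cs →
                     ∀ v → v < length cs → partialSum (suc v) cs ≤ length F + v
admissible⇒bounded F (c ∷ cs) (c≤ , adm) zero    _        = +-monoˡ-≤ 0 c≤
admissible⇒bounded F (c ∷ cs) (c≤ , adm) (suc v) (s≤s v<) = begin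
  c + partialSum (suc v) cs      ≤⟨ +-monoʳ-≤ c (admissible⇒bounded (graft F c) cs adm v v<) ⟩
  c + (length (graft F c) + v)   ≡⟨ +-length-graft F c v c≤ ⟩
  length F + suc v               ∎
  where open ≤-Reasoning

bounded⇒admissible : ∀ F cs → (∀ v → v < length cs → partialSum (suc v) cs ≤ length F + v) →
                     Admissible F cs
bounded⇒admissible F []       _       = tt
bounded⇒admissible F (c ∷ cs) bounded = c≤ , bounded⇒admissible (graft F c) cs λ v v< →
  +-cancelˡ-≤ c _ _ (subst (c + partialSum (suc v) cs ≤_) (sym (+-length-graft F c v c≤))
                           (bounded (suc v) (s≤s v<)))
  where
  c≤ : c ≤ length F
  c≤ = subst₂ _≤_ (+-identityʳ c) (+-identityʳ (length F)) (bounded 0 (s≤s z≤n))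

differences : (ℕ → ℕ) → ℕ → List ℕ
differences s zero    = []
differences s (suc k) = (s 1 ∸ s 0) ∷ differences (s ∘ suc) k

length-differences : ∀ s k → length (differences s k) ≡ k
length-differences s zero    = refl
length-differences s (suc k) = cong suc (length-differences (s ∘ suc) k)

partialSum-differences : ∀ s → (∀ x → s x ≤ s (suc x)) → ∀ k v → v ≤ k →
                         s 0 + partialSum v (differences s k) ≡ s v
partialSum-differences s step k       zero    _        = +-identityʳ (s 0)
partialSum-differences s step (suc k) (suc v) (s≤s v≤) = begin
  s 0 + ((s 1 ∸ s 0) + rest)   ≡⟨ +-assoc (s 0) _ rest ⟨
  s 0 + (s 1 ∸ s 0) + rest     ≡⟨ cong (_+ rest) (m+[n∸m]≡n (step 0)) ⟩
  s 1 + rest                   ≡⟨ partialSum-differences (s ∘ suc) (step ∘ suc) k v v≤ ⟩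
  s (suc v)                    ∎
  where
  open ≡-Reasoning
  rest = partialSum v (differences (s ∘ suc) k)

-- Child counts of a naturally labeled tree

downClosed⇒initialSegment :
  ∀ {ℓ n} {P : Pred (Fin n) ℓ} → Decidable P → (∀ {i j} → toℕ i ≤ toℕ j → P j → P i) →
  ∃ λ s → s ≤ n × (∀ i → P i ⇔ toℕ i < s)
downClosed⇒initialSegment {n = zero}  P? closed = 0 , z≤n , λ ()
downClosed⇒initialSegment {n = suc n} P? closed with P? fzero
... | no ¬P₀ = 0 , z≤n , λ i → mk⇔ (λ Pᵢ → contradiction (closed z≤n Pᵢ) ¬P₀) λ ()
... | yes P₀ with s , s≤n , seg ← downClosed⇒initialSegment (P? ∘ fsuc) (closed ∘ s≤s) =
  suc s , s≤s s≤n , λ where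
    fzero    → mk⇔ (λ _ → s≤s z≤n) (λ _ → P₀)
    (fsuc i) → mk⇔ (s≤s ∘ to (seg i)) (from (seg i) ∘ s≤s⁻¹)

initialSegment-mono :
  ∀ {ℓ ℓ′ n s t} {P : Pred (Fin n) ℓ} {Q : Pred (Fin n) ℓ′} → (∀ {i} → P i → Q i) → s ≤ n →
  (∀ i → P i ⇔ toℕ i < s) → (∀ i → Q i ⇔ toℕ i < t) → s ≤ t
initialSegment-mono P⊆Q s≤n P⇔ Q⇔ = ≮⇒≥ λ t<s →
  let i   = fromℕ< (<-≤-trans t<s s≤n)
      i≡t = toℕ-fromℕ< (<-≤-trans t<s s≤n)
  in <-irrefl i≡t (to (Q⇔ i) (P⊆Q (from (P⇔ i) (subst (_< _) (sym i≡t) t<s))))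

parentℕ : ∀ {n} → NatLabeledTree n → Fin n → ℕ
parentℕ T i = toℕ (lookupᵥ (parent T) i)

parent≤n : ∀ {n} (T : NatLabeledTree n) i → parentℕ T i ≤ n
parent≤n T i = s≤s⁻¹ (toℕ<n (lookupᵥ (parent T) i))

parent-mono : ∀ {n} (T : NatLabeledTree n) {i j} → toℕ i ≤ toℕ j → parentℕ T i ≤ parentℕ T j
parent-mono T {i} {j} i≤j = ≮⇒≥ λ pⱼ<pᵢ → <⇒≱ (natural T j i pⱼ<pᵢ) i≤j

-- cs = (c₀, …, c_{n−1}), where c_v is the number of children of the vertex v.
record ChildCounts {n} (T : NatLabeledTree n) (cs : List ℕ) : Set where
  field
    length≡  : length cs ≡ n
    parent<⇔ : ∀ v → v ≤ n → ∀ i → parentℕ T i < v ⇔ toℕ i < partialSum v cs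

childCounts-exist : ∀ {n} (T : NatLabeledTree n) → ∃ (ChildCounts T)
childCounts-exist {n} T = differences threshold n , record
  { length≡  = length-differences threshold n
  ; parent<⇔ = λ v v≤n i →
      subst (λ k → parentℕ T i < v ⇔ toℕ i < k) (sym (partialSum≡threshold v v≤n)) (segment v i)
  }
  where
  belowSegment : ∀ v → ∃ λ s → s ≤ n × (∀ i → parentℕ T i < v ⇔ toℕ i < s)
  belowSegment v = downClosed⇒initialSegment (λ i → parentℕ T i <? v)
                                             (λ i≤j pⱼ<v → ≤-<-trans (parent-mono T i≤j) pⱼ<v)
  threshold : ℕ → ℕ
  threshold v = proj₁ (belowSegment v)
  threshold≤n : ∀ v → threshold v ≤ n
  threshold≤n v = proj₁ (proj₂ (belowSegment v))
  segment : ∀ v i → parentℕ T i < v ⇔ toℕ i < threshold v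
  segment v = proj₂ (proj₂ (belowSegment v))
  threshold-step : ∀ v → threshold v ≤ threshold (suc v)
  threshold-step v = initialSegment-mono m<n⇒m<1+n (threshold≤n v) (segment v) (segment (suc v))
  threshold-zero : threshold 0 ≡ 0
  threshold-zero =
    n≤0⇒n≡0 (initialSegment-mono (λ p → p) (threshold≤n 0) (segment 0) λ _ → mk⇔ (λ ()) (λ ()))
  partialSum≡threshold : ∀ v → v ≤ n → partialSum v (differences threshold n) ≡ threshold v
  partialSum≡threshold v v≤n =
    trans (cong (_+ partialSum v (differences threshold n)) (sym threshold-zero))
          (partialSum-differences threshold threshold-step n v v≤n)

-- The index of the block of cs containing position i, i.e. the parent of i in the tree with
-- child counts cs.
locate : List ℕ → ℕ → ℕ
locate []       i = 0
locate (c ∷ cs) i with i <? c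
... | yes _ = 0
... | no  _ = suc (locate cs (i ∸ c))

locate≤length : ∀ cs i → locate cs i ≤ length cs
locate≤length []       i = z≤n
locate≤length (c ∷ cs) i with i <? c
... | yes _ = z≤n
... | no  _ = s≤s (locate≤length cs (i ∸ c))

locate<⇔ : ∀ cs i w → w ≤ length cs → locate cs i < w ⇔ i < partialSum w cs
locate<⇔ cs       i zero    _        = mk⇔ (λ ()) (λ ())
locate<⇔ (c ∷ cs) i (suc w) (s≤s w≤) with i <? c
... | yes i<c = mk⇔ (λ _ → ≤-trans i<c (m≤m+n c _)) (λ _ → s≤s z≤n)
... | no  i≮c = mk⇔
  (λ lt → subst (_< c + partialSum w cs) (m+[n∸m]≡n c≤i) (+-monoʳ-< c (to IH (s≤s⁻¹ lt))))
  (λ lt → s≤s (from IH (+-cancelˡ-< c _ _ (subst (_< c + partialSum w cs) (sym (m+[n∸m]≡n c≤i)) lt))))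
  where
  c≤i = ≮⇒≥ i≮c
  IH  = locate<⇔ cs (i ∸ c) w w≤

module _ {n cs} (p : Fin n → ℕ) (p≤n : ∀ i → p i ≤ n)
         (bounded : ∀ v → v < n → partialSum (suc v) cs ≤ v)
         (p<⇔ : ∀ v → v ≤ n → ∀ i → p i < v ⇔ toℕ i < partialSum v cs) where

  counts⇒decreasing : ∀ i → toℕ i < p i
  counts⇒decreasing i = ≰⇒> λ pᵢ≤i →
    <-irrefl refl (<-≤-trans (to (p<⇔ (suc (toℕ i)) (toℕ<n i) i) (s≤s pᵢ≤i))
                             (bounded (toℕ i) (toℕ<n i)))

  counts⇒natural : ∀ a b → p a < p b → toℕ a < toℕ b
  counts⇒natural a b pa<pb = <-≤-trans
    (to (p<⇔ (suc (p a)) v≤n a) ≤-refl)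
    (≮⇒≥ λ b< → <⇒≱ pa<pb (s≤s⁻¹ (from (p<⇔ (suc (p a)) v≤n b) b<)))
    where v≤n = ≤-trans pa<pb (p≤n b)

fromCounts : ∀ {n} cs → length cs ≡ n → (∀ v → v < n → partialSum (suc v) cs ≤ v) →
             ∃ λ (T : NatLabeledTree n) → ChildCounts T cs
fromCounts {n} cs len bounded = T , record { length≡ = len ; parent<⇔ = p<⇔ }
  where
  locate≤n : ∀ i → locate cs i ≤ n
  locate≤n i = subst (locate cs i ≤_) len (locate≤length cs i)
  parents : Vec (Fin (suc n)) n
  parents = tabulateᵥ λ i → fromℕ< (s≤s (locate≤n (toℕ i)))
  p : Fin n → ℕ
  p i = toℕ (lookupᵥ parents i)
  p≡locate : ∀ i → p i ≡ locate cs (toℕ i)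
  p≡locate i = trans (cong toℕ (lookup∘tabulate _ i)) (toℕ-fromℕ< _)
  p≤n : ∀ i → p i ≤ n
  p≤n i = subst (_≤ n) (sym (p≡locate i)) (locate≤n (toℕ i))
  p<⇔ : ∀ v → v ≤ n → ∀ i → p i < v ⇔ toℕ i < partialSum v cs
  p<⇔ v v≤n i = subst (λ k → k < v ⇔ toℕ i < partialSum v cs) (sym (p≡locate i))
                      (locate<⇔ cs (toℕ i) v (subst (v ≤_) (sym len) v≤n))
  T : NatLabeledTree n
  T = record
    { parent     = parents
    ; decreasing = counts⇒decreasing p p≤n bounded p<⇔
    ; natural    = counts⇒natural p p≤n bounded p<⇔
    }

≤-from-upperBounds : ∀ {a b n} → b ≤ n → (∀ v → v ≤ n → a < v → b < v) → b ≤ a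
≤-from-upperBounds {a} b≤n above =
  ≮⇒≥ λ a<b → <⇒≱ a<b (s≤s⁻¹ (above (suc a) (≤-trans a<b b≤n) ≤-refl))

childCounts-unique : ∀ {n cs} {T T′ : NatLabeledTree n} →
                     ChildCounts T cs → ChildCounts T′ cs → parent T ≡ parent T′
childCounts-unique {cs = cs} {T} {T′} counts counts′ = begin
  parent T                          ≡⟨ tabulate∘lookup (parent T) ⟨
  tabulateᵥ (lookupᵥ (parent T))    ≡⟨ tabulateᵥ-cong (λ i → toℕ-injective (≤-antisym
                                         (≤-parent counts counts′ i) (≤-parent counts′ counts i))) ⟩
  tabulateᵥ (lookupᵥ (parent T′))   ≡⟨ tabulate∘lookup (parent T′) ⟩
  parent T′                         ∎
  where
  open ≡-Reasoning
  open ChildCounts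
  ≤-parent : ∀ {S S′} → ChildCounts S cs → ChildCounts S′ cs →
             ∀ i → parentℕ S i ≤ parentℕ S′ i
  ≤-parent {S} c c′ i = ≤-from-upperBounds (parent≤n S i) λ v v≤n lt →
    from (parent<⇔ c v v≤n i) (to (parent<⇔ c′ v v≤n i) lt)

-- The ordered tree as an output of the queue machine

module _ {n} (T : NatLabeledTree n) where

  children-below : ∀ v → All (λ i → toℕ (inject₁ i) < toℕ v) (children T v)
  children-below v =
    All.map (λ {i} pᵢ≡v → subst₂ _<_ (sym (toℕ-inject₁ i)) (cong toℕ pᵢ≡v) (decreasing T i))
            (all-filter (λ i → lookupᵥ (parent T) i ≟ v) (allFin n))

  subtree-fuel : ∀ f g v → toℕ v < f → toℕ v < g → subtree T f v ≡ subtree T g v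
  subtree-fuel (suc f) (suc g) v v<f v<g = cong node (map-cong-local (All.map
    (λ {i} i<v → subtree-fuel f g (inject₁ i) (<-≤-trans i<v (s≤s⁻¹ v<f))
                                              (<-≤-trans i<v (s≤s⁻¹ v<g)))
    (children-below v)))

  -- The vertex with label k ≤ n; the ⊓ n only makes it total.
  vertex : ℕ → Fin (suc n)
  vertex k = fromℕ< (s≤s (m⊓n≤n k n))

  toℕ-vertex : ∀ {k} → k ≤ n → toℕ (vertex k) ≡ k
  toℕ-vertex k≤n = trans (toℕ-fromℕ< _) (m≤n⇒m⊓n≡m k≤n)

  subtreeAt : ℕ → OTree
  subtreeAt k = subtree T (suc k) (vertex k)

  subtreeAt-unfold : ∀ {k} → k ≤ n → subtreeAt k ≡ node (map subtreeAt (map toℕ (children T (vertex k))))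
  subtreeAt-unfold {k} k≤n = cong node (trans (map-cong-local (All.map fuel≡ (children-below (vertex k))))
                                              (map-∘ (children T (vertex k))))
    where
    vertex-toℕ : ∀ i → vertex (toℕ i) ≡ inject₁ i
    vertex-toℕ i = toℕ-injective (trans (toℕ-vertex (<⇒≤ (toℕ<n i))) (sym (toℕ-inject₁ i)))
    fuel≡ : ∀ {i} → toℕ (inject₁ i) < toℕ (vertex k) → subtree T k (inject₁ i) ≡ subtreeAt (toℕ i)
    fuel≡ {i} i<k = trans
      (subtree-fuel k (suc (toℕ i)) (inject₁ i) (subst (_ <_) (toℕ-vertex k≤n) i<k)
                    (s≤s (≤-reflexive (toℕ-inject₁ i))))
      (cong (subtree T (suc (toℕ i))) (sym (vertex-toℕ i)))

  children-segment : ∀ v a c → v ≤ n → a + c ≤ n →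
                     (∀ i → parentℕ T i ≡ v ⇔ (a ≤ toℕ i × toℕ i < a + c)) →
                     map toℕ (children T (vertex v)) ≡ range a (a + c)
  children-segment v a c v≤n a+c≤n seg = trans
    (cong (map toℕ) (filter-tabulate-segment (λ i → lookupᵥ (parent T) i ≟ vertex v)
                                             (λ i → i) a c λ i →
      mk⇔ (to (seg i) ∘ (λ e → trans e (toℕ-vertex v≤n)) ∘ cong toℕ)
          (toℕ-injective ∘ (λ e → trans e (sym (toℕ-vertex v≤n))) ∘ from (seg i))))
    (map-toℕ-take-drop-allFin a c a+c≤n)

≡⇔between : ∀ {p v i a b} → (p < v ⇔ i < a) → (p < suc v ⇔ i < b) → (p ≡ v ⇔ (a ≤ i × i < b))
≡⇔between below below′ = mk⇔
  (λ p≡v → ≮⇒≥ (λ i<a → <-irrefl p≡v (from below i<a)) , to below′ (s≤s (≤-reflexive p≡v)))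
  (λ (a≤i , i<b) →
    ≤-antisym (s≤s⁻¹ (from below′ i<b)) (≮⇒≥ λ p<v → <⇒≱ (to below p<v) a≤i))

module _ {n} {T : NatLabeledTree n} {cs} (counts : ChildCounts T cs) where
  open ChildCounts counts

  partialSum-suc≤ : ∀ v → v < n → partialSum (suc v) cs ≤ v
  partialSum-suc≤ v v<n = ≮⇒≥ λ v<S → <⇒≱ (decreasing T i)
    (subst (parentℕ T i ≤_) (sym i≡v)
      (s≤s⁻¹ (from (parent<⇔ (suc v) v<n i) (subst (_< _) (sym i≡v) v<S))))
    where
    i   = fromℕ< v<n
    i≡v = toℕ-fromℕ< v<n

  partialSum≤ : ∀ v → v ≤ n → partialSum v cs ≤ v
  partialSum≤ zero    _   = z≤n
  partialSum≤ (suc v) v<n = ≤-trans (partialSum-suc≤ v v<n) (n≤1+n v)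

  children-inner : ∀ v c → v < n → partialSum (suc v) cs ≡ partialSum v cs + c →
                   map toℕ (children T (vertex T v)) ≡ range (partialSum v cs) (partialSum v cs + c)
  children-inner v c v<n e = children-segment T v (partialSum v cs) c (<⇒≤ v<n)
    (≤-trans (≤-reflexive (sym e)) (≤-trans (partialSum-suc≤ v v<n) (<⇒≤ v<n))) λ i →
    ≡⇔between (parent<⇔ v (<⇒≤ v<n) i)
              (subst (λ k → parentℕ T i < suc v ⇔ toℕ i < k) e (parent<⇔ (suc v) v<n i))

  children-root : map toℕ (children T (vertex T n)) ≡ range (partialSum n cs) n
  children-root = subst (λ b → map toℕ (children T (vertex T n)) ≡ range a b) a+c≡n
    (children-segment T n a (n ∸ a) ≤-refl (≤-reflexive a+c≡n) λ i →
      ≡⇔between (parent<⇔ n ≤-refl i)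
                (mk⇔ (λ _ → subst (toℕ i <_) (sym a+c≡n) (toℕ<n i)) (λ _ → s≤s (parent≤n T i))))
    where
    a = partialSum n cs
    a+c≡n = m+[n∸m]≡n (partialSum≤ n ≤-refl)

  -- The queue just before vertex v is processed: the subtrees at the vertices
  -- partialSum v cs, …, v − 1, i.e. those below v whose parent is not.
  pending : ℕ → List OTree
  pending v = map (subtreeAt T) (range (partialSum v cs) v)

  graft-pending : ∀ v c → v < n → partialSum (suc v) cs ≡ partialSum v cs + c →
                  graft (pending v) c ≡ pending (suc v)
  graft-pending v c v<n e = begin
    drop c (map sub (range a v)) ∷ʳ node (take c (map sub (range a v)))
      ≡⟨ cong₂ (λ F G → F ∷ʳ node G) (drop-map c (range a v)) (take-map c (range a v)) ⟩
    map sub (drop c (range a v)) ∷ʳ node (map sub (take c (range a v)))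
      ≡⟨ cong₂ (λ xs ys → map sub xs ∷ʳ node (map sub ys))
               (drop-range a c v) (take-range a c a+c≤v) ⟩
    map sub (range (a + c) v) ∷ʳ node (map sub (range a (a + c)))
      ≡⟨ cong₂ (λ b t → map sub (range b v) ∷ʳ t) e subtree≡ ⟨
    map sub (range b v) ∷ʳ sub v
      ≡⟨ map-++ sub (range b v) (v ∷ []) ⟨
    map sub (range b v ∷ʳ v)
      ≡⟨ cong (map sub) (range-∷ʳ (partialSum-suc≤ v v<n)) ⟩
    pending (suc v) ∎
    where
    open ≡-Reasoning
    sub = subtreeAt T
    a = partialSum v cs
    b = partialSum (suc v) cs
    a+c≤v : a + c ≤ v
    a+c≤v = subst (_≤ v) e (partialSum-suc≤ v v<n)
    subtree≡ : sub v ≡ node (map sub (range a (a + c)))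
    subtree≡ = trans (subtreeAt-unfold T (<⇒≤ v<n)) (cong (node ∘ map sub) (children-inner v c v<n e))

  run-take : ∀ v → v ≤ n → run [] (take v cs) ≡ pending v
  run-take zero    _   = refl
  run-take (suc v) v<n with c , take≡ ← take-suc-∷ʳ cs (subst (v <_) (sym length≡) v<n) = begin
    run [] (take (suc v) cs)       ≡⟨ cong (run []) take≡ ⟩
    run [] (take v cs ∷ʳ c)        ≡⟨ foldl-∷ʳ graft [] c (take v cs) ⟩
    graft (run [] (take v cs)) c   ≡⟨ cong (λ F → graft F c) (run-take v (<⇒≤ v<n)) ⟩
    graft (pending v) c            ≡⟨ graft-pending v c v<n (partialSum-∷ʳ v cs take≡) ⟩
    pending (suc v)                ∎
    where open ≡-Reasoning

  toOrdered≡run : toOrdered T ≡ node (run [] cs)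
  toOrdered≡run = begin
    subtree T (suc n) (fromℕ n)
      ≡⟨ cong (subtree T (suc n)) (toℕ-injective (trans (toℕ-fromℕ n) (sym (toℕ-vertex T ≤-refl)))) ⟩
    subtreeAt T n
      ≡⟨ subtreeAt-unfold T ≤-refl ⟩
    node (map (subtreeAt T) (map toℕ (children T (vertex T n))))
      ≡⟨ cong (node ∘ map (subtreeAt T)) children-root ⟩
    node (pending n)
      ≡⟨ cong node (run-take n ≤-refl) ⟨
    node (run [] (take n cs))
      ≡⟨ cong (node ∘ run []) (take-all n cs (≤-reflexive length≡)) ⟩
    node (run [] cs) ∎
    where open ≡-Reasoning

  childCounts-admissible : Admissible [] cs
  childCounts-admissible = bounded⇒admissible [] cs λ v v< → partialSum-suc≤ v (subst (v <_) length≡ v<)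

size-toOrdered : ∀ {n} (T : NatLabeledTree n) → size (toOrdered T) ≡ suc n
size-toOrdered {n} T with cs , counts ← childCounts-exist T = begin
  size (toOrdered T)        ≡⟨ cong size (toOrdered≡run counts) ⟩
  suc (sizes (run [] cs))   ≡⟨ cong suc (sizes-run [] cs) ⟩
  suc (length cs + 0)       ≡⟨ cong suc (trans (+-identityʳ _) (ChildCounts.length≡ counts)) ⟩
  suc n                     ∎
  where open ≡-Reasoning

toOrdered-injective : ∀ {n} (T T′ : NatLabeledTree n) →
                      toOrdered T ≡ toOrdered T′ → parent T ≡ parent T′
toOrdered-injective T T′ eq
  with cs  , counts  ← childCounts-exist T
  with cs′ , counts′ ← childCounts-exist T′
  with refl , _ ← run-injective cs cs′
                    (trans (ChildCounts.length≡ counts) (sym (ChildCounts.length≡ counts′)))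
                    (childCounts-admissible counts) (childCounts-admissible counts′)
                    (node-injective (trans (sym (toOrdered≡run counts)) (trans eq (toOrdered≡run counts′))))
  = childCounts-unique counts counts′

toOrdered-surjective : ∀ {n} (t : OTree) → size t ≡ suc n →
                       ∃ λ (T : NatLabeledTree n) → toOrdered T ≡ t
toOrdered-surjective {n} (node ts) size≡
  with cs , len , adm , run≡ ← run-surjective n ts (suc-injective size≡)
  with T , counts ← fromCounts cs len (λ v v<n → admissible⇒bounded [] cs adm v (subst (v <_) (sym len) v<n))
  = T , trans (toOrdered≡run counts) (cong node run≡)

corollary3p7 : ∀ (n : ℕ)
    → ((T : NatLabeledTree n) → size (toOrdered T) ≡ suc n)
    × (∀ (T T′ : NatLabeledTree n) → toOrdered T ≡ toOrdered T′ → parent T ≡ parent T′)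
    × (∀ (t : OTree) → size t ≡ suc n → ∃ λ (T : NatLabeledTree n) → toOrdered T ≡ t)
corollary3p7 n = size-toOrdered , toOrdered-injective , toOrdered-surjective
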